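{- Let $G$ be a finite graph and let $(M,X,N)$ be a separation of $G$ in which $X$ is a clique that is a cut-set of $G$. Suppose $P$ and $Q$ are detours of $G$ such that (1) neither $P$ nor $Q$ has an end vertex in $X$; (2) each of $P$ and $Q$ contains a vertex of $M$ and a vertex of $N$; and (3) $f(P,M)=f(Q,M)$. Then $V(P)\cap V(Q)\cap X \neq \emptyset$.
   Context: A separation of $G$ is a partition $(M,X,N)$ of $V(G)$ such that no edge of $G$ has one end vertex in $M$ and the other in $N$. A detour of $G$ is a longest path of $G$, i.e. a path with the maximum number of vertices among all paths in $G$. For a path $P$ and a set $M \subseteq V(G)$, $f(P,M)\in\{0,1,2\}$ denotes the number of end vertices of $P$ lying in $M$. -}

module Defs where

open import Data.Nat using (ℕ; _+_; _≤_)
open import Data.Fin using (Fin)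
open import Data.List using (List; []; _∷_; length)
open import Data.List.Membership.Propositional using (_∈_)
open import Data.List.Relation.Unary.All using (All)
open import Data.List.Relation.Unary.Unique.Propositional using (Unique)
open import Data.List.Relation.Unary.Linked using (Linked)
open import Data.Product using (Σ; _×_; ∃)
open import Relation.Binary.PropositionalEquality using (_≡_; _≢_)
open import Relation.Nullary using (¬_)
open import Level using (Level; suc; zero)

record Graph (n : ℕ) : Set₁ where
  field
    Adj    : Fin n → Fin n → Set
    sym    : ∀ {u v} → Adj u v → Adj v u
    irrefl : ∀ {u} → ¬ Adj u u
open Graph public

record Path {n : ℕ} (G : Graph n) : Set where
  constructor mkPath
  field
    start    : Fin n
    rest     : List (Fin n)
    distinct : Unique (start ∷ rest)
    walk     : Linked (Adj G) (start ∷ rest)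
open Path public

verts : ∀ {n} {G : Graph n} → Path G → List (Fin n)
verts p = start p ∷ rest p

order : ∀ {n} {G : Graph n} → Path G → ℕ
order p = length (verts p)

lastOf : ∀ {n} → Fin n → List (Fin n) → Fin n
lastOf x []       = x
lastOf x (y ∷ ys) = lastOf y ys

endL endR : ∀ {n} {G : Graph n} → Path G → Fin n
endL p = start p
endR p = lastOf (start p) (rest p)

IsDetour : ∀ {n} (G : Graph n) → Path G → Set
IsDetour G p = ∀ (q : Path G) → order q ≤ order p

data Part : Set where
  inM inX inN : Part

IsSeparation : ∀ {n} (G : Graph n) → (Fin n → Part) → Set
IsSeparation G part = ∀ u v → Adj G u v → ¬ (part u ≡ inM × part v ≡ inN)

IsCliqueX : ∀ {n} (G : Graph n) → (Fin n → Part) → Set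
IsCliqueX G part = ∀ u v → part u ≡ inX → part v ≡ inX → u ≢ v → Adj G u v

IsCutSetX : ∀ {n : ℕ} (G : Graph n) → (Fin n → Part) → Set
IsCutSetX {n} G part =
  Σ (Fin n) λ u → Σ (Fin n) λ v → part u ≢ inX × part v ≢ inX ×
    ¬ (Σ (Path G) λ p → endL p ≡ u × endR p ≡ v × All (λ w → part w ≢ inX) (verts p))

indM : Part → ℕ
indM inM = 1
indM inX = 0
indM inN = 0

f : ∀ {n} {G : Graph n} → Path G → (Fin n → Part) → ℕ
f p part = indM (part (endL p)) + indM (part (endR p))

module Submission where

-- Suppose the detours P and Q (of common length k) share no vertex of X. Deleting the N-vertices
-- of one and the M-vertices of the other leaves two vertex-disjoint lists whose gaps lie in the
-- clique X; because f(P,M) = f(Q,M), their ends can be matched so that the two lists splice into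
-- a single path (reversing a path if needed, or inserting one into the other at a deleted vertex).
-- Splicing both ways gives two paths of total length |P∖M| + |P∖N| + |Q∖M| + |Q∖N|
-- = |P| + |P ∩ X| + |Q| + |Q ∩ X| > 2k, because P runs from M to N and so through X.
-- So one of them is longer than a detour.

open import Defs
open import Data.Empty using (⊥; ⊥-elim)
open import Data.Fin using (Fin)
open import Data.Fin.Properties using () renaming (_≟_ to _≟ᶠ_)
open import Data.List using (List; []; _∷_; _++_; _∷ʳ_; length; filter; head; last; reverse)
open import Data.List.Properties using (length-++; filter-++; filter-some; unfold-reverse; reverse-involutive)
open import Data.List.Membership.Propositional using (_∈_; find; lose)
open import Data.List.Membership.Propositional.Properties using (∈-filter⁻; ∈-∃++)
open import Data.List.Relation.Binary.Permutation.Propositional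
  using (_↭_; ↭-refl; ↭-sym; ↭-trans; ↭-reflexive; ↭⇒↭ₛ)
import Data.List.Relation.Binary.Permutation.Setoid.Properties as Permutationₛ
open import Data.List.Relation.Binary.Disjoint.Propositional using (Disjoint)
open import Data.List.Relation.Binary.Permutation.Propositional.Properties
  using (↭-length; ↭-reverse; ∈-resp-↭; Any-resp-↭; ++⁺ˡ; ++-comm; ++-assoc)
open import Data.List.Relation.Unary.All.Properties using (¬Any⇒All¬)
open import Data.List.Relation.Unary.All using (All; []; _∷_) renaming (map to All-map; lookup to All-lookup)
open import Data.List.Relation.Unary.AllPairs using (_∷_)
open import Data.List.Relation.Unary.Any using (Any; any?)
open import Data.List.Relation.Unary.Linked using (Linked; []; [-]; _∷_; _∷′_) renaming (tail to Linked-tail)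
open import Data.List.Relation.Unary.Linked.Properties using () renaming (++⁺ to Linked-++⁺)
open import Data.List.Relation.Unary.Unique.Propositional using (Unique)
open import Data.List.Relation.Unary.Unique.Propositional.Properties
  using () renaming (++⁺ to Unique-++⁺; filter⁺ to Unique-filter⁺)
open import Data.Maybe using (just; nothing)
open import Data.Maybe.Relation.Binary.Connected using (Connected; just; just-nothing; nothing-just; nothing)
open import Data.Maybe.Relation.Unary.All using (just; nothing) renaming (All to AllMaybe)
open import Data.Nat using (ℕ; suc; _+_; _≤_; _<_; z≤n)
open import Data.Nat.Properties
  using (+-commutativeSemigroup; +-suc; +-comm; m≤m+n; +-mono-≤; +-mono-<-≤; m<m+n; <-irrefl; module ≤-Reasoning)
open import Algebra.Properties.CommutativeSemigroup +-commutativeSemigroup using (interchange)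
open import Data.Product using (Σ; _×_; _,_; proj₁; proj₂)
open import Data.Sum using (_⊎_; inj₁; inj₂)
open import Function using (_∘_)
open import Relation.Binary.Definitions using (Symmetric; DecidableEquality)
open import Relation.Binary.PropositionalEquality using (_≡_; _≢_; refl; trans; cong; subst; setoid)
  renaming (sym to ≡-sym)
open import Relation.Nullary using (¬_; yes; no; Dec; ¬?; _×-dec_)
open import Relation.Nullary.Decidable using (map′)

_≟_ : DecidableEquality Part
inM ≟ inM = yes refl
inM ≟ inX = no λ ()
inM ≟ inN = no λ ()
inX ≟ inM = no λ ()
inX ≟ inX = yes refl
inX ≟ inN = no λ ()
inN ≟ inM = no λ ()
inN ≟ inX = no λ ()
inN ≟ inN = yes refl

module _ {a} {A : Set a} where

  last-∷ʳ : ∀ (xs : List A) x → last (xs ∷ʳ x) ≡ just x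
  last-∷ʳ []           x = refl
  last-∷ʳ (_ ∷ [])     x = refl
  last-∷ʳ (_ ∷ y ∷ ys) x = last-∷ʳ (y ∷ ys) x

  last-reverse : ∀ (xs : List A) → last (reverse xs) ≡ head xs
  last-reverse []       = refl
  last-reverse (x ∷ xs) = trans (cong last (unfold-reverse x xs)) (last-∷ʳ (reverse xs) x)

  head-reverse : ∀ (xs : List A) → head (reverse xs) ≡ last xs
  head-reverse xs = trans (≡-sym (last-reverse (reverse xs))) (cong last (reverse-involutive xs))

  Unique-resp-↭ : ∀ {xs ys : List A} → xs ↭ ys → Unique xs → Unique ys
  Unique-resp-↭ xs↭ys = Permutationₛ.Unique-resp-↭ (setoid A) (↭⇒↭ₛ xs↭ys)

  Linked-++⁻ : ∀ {ℓ} {R : A → A → Set ℓ} xs {y ys} → Linked R (xs ++ y ∷ ys) → Linked R (xs ∷ʳ y) × Linked R (y ∷ ys)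
  Linked-++⁻ []           linked        = [-] , linked
  Linked-++⁻ (_ ∷ [])     (r ∷ linked)  = r ∷ [-] , linked
  Linked-++⁻ (_ ∷ x ∷ xs) (r ∷ linked)  = let (prefix , suffix) = Linked-++⁻ (x ∷ xs) linked in r ∷ prefix , suffix

  Linked-reverse : ∀ {ℓ} {R : A → A → Set ℓ} → Symmetric R → ∀ {xs} → Linked R xs → Linked R (reverse xs)
  Linked-reverse sym []  = []
  Linked-reverse sym [-] = [-]
  Linked-reverse {R = R} sym {x ∷ y ∷ ys} (xy ∷ rest) =
    subst (Linked R) (≡-sym (unfold-reverse x (y ∷ ys)))
      (Linked-++⁺ (Linked-reverse sym rest) joint [-])
    where
      joint : Connected R (last (reverse (y ∷ ys))) (just x)
      joint = subst (λ m → Connected R m (just x)) (≡-sym (last-reverse (y ∷ ys))) (just (sym xy))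

last-lastOf : ∀ {n} (x : Fin n) xs → last (x ∷ xs) ≡ just (lastOf x xs)
last-lastOf x []       = refl
last-lastOf x (y ∷ ys) = last-lastOf y ys

crossed-sums-impossible : ∀ {k x y z w} → k < x + y → k ≤ z + w → x + z ≤ k → y + w ≤ k → ⊥
crossed-sums-impossible {k} {x} {y} {z} {w} k<x+y k≤z+w x+z≤k y+w≤k = <-irrefl refl (begin-strict
  k + k               <⟨ +-mono-<-≤ k<x+y k≤z+w ⟩
  (x + y) + (z + w)   ≡⟨ interchange x y z w ⟩
  (x + z) + (y + w)   ≤⟨ +-mono-≤ x+z≤k y+w≤k ⟩
  k + k               ∎)
  where open ≤-Reasoning

data Opposite : Part → Part → Set where
  M-N : Opposite inM inN
  N-M : Opposite inN inM

opposite-sym : ∀ {d e} → Opposite d e → Opposite e d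
opposite-sym M-N = N-M
opposite-sym N-M = M-N

opposite-≢X : ∀ {d e} → Opposite d e → d ≢ inX
opposite-≢X M-N ()
opposite-≢X N-M ()

module Labelling {n : ℕ} (part : Fin n → Part) where

  open import Data.List.Membership.DecPropositional (_≟ᶠ_ {n}) using (_∈?_)

  Vertex : Set
  Vertex = Fin n

  InX : Vertex → Set
  InX v = part v ≡ inX

  StartsIn EndsIn : Part → List Vertex → Set
  StartsIn a l = AllMaybe (λ v → part v ≡ a) (head l)
  EndsIn   a l = AllMaybe (λ v → part v ≡ a) (last l)

  delete : Part → List Vertex → List Vertex
  delete d = filter (λ v → ¬? (part v ≟ d))

  NoCommonX : List Vertex → List Vertex → Set
  NoCommonX A B = ∀ {v} → v ∈ A → v ∈ B → ¬ InX v

  common-X? : ∀ A B → Dec (Σ Vertex λ v → v ∈ A × v ∈ B × InX v)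
  common-X? A B = map′ find (λ (_ , v∈A , hit) → lose v∈A hit) (any? (λ v → (v ∈? B) ×-dec (part v ≟ inX)) A)

  opposite-cover : ∀ {d e v} → Opposite d e → part v ≢ d → part v ≢ e → InX v
  opposite-cover {v = v} de v≢d v≢e with part v | de
  ... | inX | _   = refl
  ... | inM | M-N = ⊥-elim (v≢d refl)
  ... | inM | N-M = ⊥-elim (v≢e refl)
  ... | inN | M-N = ⊥-elim (v≢e refl)
  ... | inN | N-M = ⊥-elim (v≢d refl)

  delete-disjoint : ∀ {d e A B} → Opposite d e → NoCommonX A B → Disjoint (delete d A) (delete e B)
  delete-disjoint {d} {e} de noX (v∈A′ , v∈B′)
    with ∈-filter⁻ (λ v → ¬? (part v ≟ d)) v∈A′ | ∈-filter⁻ (λ v → ¬? (part v ≟ e)) v∈B′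
  ... | v∈A , v≢d | v∈B , v≢e = noX v∈A v∈B (opposite-cover de v≢d v≢e)

  delete-∷ʳ : ∀ {d v} xs → part v ≡ d → delete d (xs ∷ʳ v) ≡ delete d xs
  delete-∷ʳ {d} {v} [] pv with part v ≟ d
  ... | yes _   = refl
  ... | no v≢d  = ⊥-elim (v≢d pv)
  delete-∷ʳ {d} (x ∷ xs) pv with part x ≟ d
  ... | yes _ = delete-∷ʳ xs pv
  ... | no _  = cong (x ∷_) (delete-∷ʳ xs pv)

  countX : List Vertex → ℕ
  countX l = length (filter (λ v → part v ≟ inX) l)

  length-delete-M+N : ∀ l → length (delete inM l) + length (delete inN l) ≡ length l + countX l
  length-delete-M+N [] = refl
  length-delete-M+N (v ∷ l) with part v
  ... | inM = trans (+-suc _ _) (cong suc (length-delete-M+N l))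
  ... | inN = cong suc (length-delete-M+N l)
  ... | inX = cong suc (trans (+-suc _ _) (trans (cong suc (length-delete-M+N l)) (≡-sym (+-suc _ _))))

  length-delete-opposite : ∀ {d e} → Opposite d e → ∀ l →
    length (delete d l) + length (delete e l) ≡ length l + countX l
  length-delete-opposite M-N l = length-delete-M+N l
  length-delete-opposite N-M l = trans (+-comm (length (delete inN l)) _) (length-delete-M+N l)

  exchanged-deletions-exceed : ∀ {d e} → Opposite d e → ∀ {k} A B → Any InX A → length A ≡ k → k ≤ length B →
    length (delete d A) + length (delete e B) ≤ k →
    length (delete d B) + length (delete e A) ≤ k → ⊥
  exchanged-deletions-exceed {d} {e} de {k} A B A-meets-X |A|≡k k≤|B| AB≤k BA≤k =
    crossed-sums-impossible {k} {length (delete d A)} {length (delete e A)} {length (delete e B)} {length (delete d B)}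
      A-sum B-sum AB≤k (subst (_≤ k) (+-comm (length (delete d B)) _) BA≤k)
    where
      open ≤-Reasoning
      A-sum : k < length (delete d A) + length (delete e A)
      A-sum = begin-strict
        k                  ≡⟨ ≡-sym |A|≡k ⟩
        length A           <⟨ m<m+n (length A) (filter-some (λ v → part v ≟ inX) A-meets-X) ⟩
        length A + countX A ≡⟨ ≡-sym (length-delete-opposite de A) ⟩
        length (delete d A) + length (delete e A) ∎
      B-sum : k ≤ length (delete e B) + length (delete d B)
      B-sum = begin
        k                  ≤⟨ k≤|B| ⟩
        length B           ≤⟨ m≤m+n (length B) (countX B) ⟩
        length B + countX B ≡⟨ ≡-sym (length-delete-opposite (opposite-sym de) B) ⟩
        length (delete e B) + length (delete d B) ∎

module Separation {n : ℕ} (G : Graph n) (part : Fin n → Part)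
  (sep : IsSeparation G part) (clique : IsCliqueX G part) where

  open Labelling part

  Joinable : Vertex → Vertex → Set
  Joinable u v = Adj G u v ⊎ (InX u × InX v)

  X-connected : ∀ {mu mv} → AllMaybe InX mu → AllMaybe InX mv → Connected Joinable mu mv
  X-connected (just uX) (just vX) = just (inj₂ (uX , vX))
  X-connected (just _)  nothing   = just-nothing
  X-connected nothing   (just _)  = nothing-just
  X-connected nothing   nothing   = nothing

  ++-joinable : ∀ {xs ys} → Linked Joinable xs → Linked Joinable ys →
    EndsIn inX xs → StartsIn inX ys → Linked Joinable (xs ++ ys)
  ++-joinable xs-walk ys-walk xs-end ys-start = Linked-++⁺ xs-walk (X-connected xs-end ys-start) ys-walk

  StartsIn-++ : ∀ {a} xs {ys} → StartsIn a xs → StartsIn a ys → StartsIn a (xs ++ ys)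
  StartsIn-++ []      _       ys-start = ys-start
  StartsIn-++ (_ ∷ _) xs-start _       = xs-start

  joinable⇒adjacent : ∀ {l} → Unique l → Linked Joinable l → Linked (Adj G) l
  joinable⇒adjacent _                  []                        = []
  joinable⇒adjacent _                  [-]                       = [-]
  joinable⇒adjacent ((u≢v ∷ _) ∷ uniq) (inj₁ uv ∷ walk)          = uv ∷ joinable⇒adjacent uniq walk
  joinable⇒adjacent ((u≢v ∷ _) ∷ uniq) (inj₂ (uX , vX) ∷ walk)   = clique _ _ uX vX u≢v ∷ joinable⇒adjacent uniq walk

  sealed : ∀ {d u v} → d ≢ inX → Adj G u v → part u ≡ d → part v ≢ d → InX v
  sealed {inX} d≢X _ _ _ = ⊥-elim (d≢X refl)
  sealed {inM} {u} {v} _ uv pu v≢d with part v in pv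
  ... | inM = ⊥-elim (v≢d refl)
  ... | inX = refl
  ... | inN = ⊥-elim (sep u v uv (pu , pv))
  sealed {inN} {u} {v} _ uv pu v≢d with part v in pv
  ... | inN = ⊥-elim (v≢d refl)
  ... | inX = refl
  ... | inM = ⊥-elim (sep v u (sym G uv) (pv , pu))

  -- A maximal run of d-vertices on a path is flanked by vertices of X, so after deleting the
  -- d-vertices every gap is bridged inside the clique X.
  module Deletion {d : Part} (d≢X : d ≢ inX) where

    delete-after : ∀ {v vs} → Linked (Adj G) (v ∷ vs) → part v ≡ d → StartsIn inX (delete d vs)
    delete-after {vs = []}    _           _  = nothing
    delete-after {vs = w ∷ _} (vw ∷ rest) pv with part w ≟ d
    ... | yes pw  = delete-after rest pw
    ... | no w≢d  = just (sealed d≢X vw pv w≢d)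

    delete-head : ∀ {l} → Linked (Adj G) l → StartsIn d l → StartsIn inX (delete d l)
    delete-head {[]}    _      _         = nothing
    delete-head {v ∷ _} linked (just pv) with part v ≟ d
    ... | yes _   = delete-after linked pv
    ... | no v≢d  = ⊥-elim (v≢d pv)

    delete-≡[] : ∀ {v vs} → delete d (v ∷ vs) ≡ [] → part v ≡ d
    delete-≡[] {v} with part v ≟ d
    ... | yes pv = λ _ → pv
    ... | no _   = λ ()

    EndsIn-∷ : ∀ {a v} l → EndsIn a l → (l ≡ [] → part v ≡ a) → EndsIn a (v ∷ l)
    EndsIn-∷ []      _   pv = just (pv refl)
    EndsIn-∷ (_ ∷ _) end _  = end

    delete-last : ∀ {l} → Linked (Adj G) l → EndsIn d l → EndsIn inX (delete d l)
    delete-last {[]}    _ _ = nothing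
    delete-last {v ∷ []} _ (just pv) with part v ≟ d
    ... | yes _   = nothing
    ... | no v≢d  = ⊥-elim (v≢d pv)
    delete-last {v ∷ w ∷ ws} (vw ∷ rest) end with part v ≟ d
    ... | yes _   = delete-last rest end
    ... | no v≢d  = EndsIn-∷ (delete d (w ∷ ws)) (delete-last rest end)
                      (λ empty → sealed d≢X (sym G vw) (delete-≡[] empty) v≢d)

    delete-next : ∀ {v vs} → Linked (Adj G) (v ∷ vs) → part v ≢ d →
      Connected Joinable (just v) (head (delete d vs))
    delete-next {vs = []}    _           _   = just-nothing
    delete-next {vs = w ∷ _} (vw ∷ rest) v≢d with part w ≟ d
    ... | no _   = just (inj₁ vw)
    ... | yes pw = X-connected (just (sealed d≢X (sym G vw) pw v≢d)) (delete-after rest pw)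

    delete-walk : ∀ {l} → Linked (Adj G) l → Linked Joinable (delete d l)
    delete-walk {[]}    _      = []
    delete-walk {v ∷ _} linked with part v ≟ d
    ... | yes _  = delete-walk (Linked-tail linked)
    ... | no v≢d = delete-next linked v≢d ∷′ delete-walk (Linked-tail linked)

  open Deletion

  Splice : Part → Part → List Vertex → List Vertex → Set
  Splice d e A B = Σ (List Vertex) λ C → C ↭ delete d A ++ delete e B × Linked Joinable C

  crossing-splice : ∀ {d e A B} → Opposite d e →
    Linked (Adj G) A → EndsIn d A → Linked (Adj G) B → StartsIn e B → Splice d e A B
  crossing-splice de A-walk A-end B-walk B-start =
    _ , ↭-refl ,
    ++-joinable (delete-walk d≢X A-walk) (delete-walk e≢X B-walk)
      (delete-last d≢X A-walk A-end) (delete-head e≢X B-walk B-start)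
    where
      d≢X = opposite-≢X de
      e≢X = opposite-≢X (opposite-sym de)

  -- The d-vertex v cuts A into two pieces whose deletions end and start in X; B is inserted between them.
  inserting-splice : ∀ {d e A B v} → Opposite d e → Linked (Adj G) A → v ∈ A → part v ≡ d →
    Linked (Adj G) B → StartsIn e B → EndsIn e B → Splice d e A B
  inserting-splice {d} {e} {B = B} {v} de A-walk v∈A pv B-walk B-start B-end with ∈-∃++ v∈A
  ... | pre , post , refl =
    pre′ ++ B′ ++ post′ , rearrange ,
    ++-joinable pre′-walk (++-joinable (delete-walk e≢X B-walk) (delete-walk d≢X post-walk)
                                       (delete-last e≢X B-walk B-end) post′-start)
      pre′-end (StartsIn-++ B′ (delete-head e≢X B-walk B-start) post′-start)
    where
      d≢X = opposite-≢X de
      e≢X = opposite-≢X (opposite-sym de)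
      pre′ = delete d pre
      B′ = delete e B
      post′ = delete d (v ∷ post)
      pieces = Linked-++⁻ pre A-walk
      pre-walk = proj₁ pieces
      post-walk = proj₂ pieces
      pre′≡ : delete d (pre ∷ʳ v) ≡ pre′
      pre′≡ = delete-∷ʳ pre pv
      pre′-walk : Linked Joinable pre′
      pre′-walk = subst (Linked Joinable) pre′≡ (delete-walk d≢X pre-walk)
      pre′-end : EndsIn inX pre′
      pre′-end = subst (EndsIn inX) pre′≡
        (delete-last d≢X pre-walk (subst (AllMaybe _) (≡-sym (last-∷ʳ pre v)) (just pv)))
      post′-start : StartsIn inX post′
      post′-start = delete-head d≢X post-walk (just pv)
      rearrange : pre′ ++ B′ ++ post′ ↭ delete d (pre ++ v ∷ post) ++ B′
      rearrange = ↭-trans (++⁺ˡ pre′ (++-comm B′ post′))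
        (↭-trans (↭-sym (++-assoc pre′ post′ B′))
          (↭-reflexive (cong (_++ B′) (≡-sym (filter-++ (λ u → ¬? (part u ≟ d)) pre (v ∷ post))))))

  detour-bound : ∀ {P l} → IsDetour G P → Unique l → Linked (Adj G) l → length l ≤ order P
  detour-bound {l = []}    _        _    _      = z≤n
  detour-bound {l = v ∷ vs} P-detour uniq linked = P-detour (mkPath v vs uniq linked)

  splice-bound : ∀ {P d e A B} → IsDetour G P → Opposite d e → NoCommonX A B → Unique A → Unique B →
    Splice d e A B → length (delete d A) + length (delete e B) ≤ order P
  splice-bound {P} {d} {e} {A} {B} P-detour de noX A-unique B-unique (C , C↭ , C-walk) =
    subst (_≤ order P) (trans (↭-length C↭) (length-++ (delete d A)))
      (detour-bound {P} P-detour C-unique (joinable⇒adjacent C-unique C-walk))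
    where
      C-unique : Unique C
      C-unique = Unique-resp-↭ (↭-sym C↭)
        (Unique-++⁺ (Unique-filter⁺ (λ u → ¬? (part u ≟ d)) A-unique)
                    (Unique-filter⁺ (λ u → ¬? (part u ≟ e)) B-unique) (delete-disjoint de noX))

  adjacent-same-side : ∀ {u v} → ¬ InX u → ¬ InX v → Adj G u v → part v ≡ part u
  adjacent-same-side {u} {v} u∉X v∉X uv with part v ≟ part u
  ... | yes same  = same
  ... | no differ = ⊥-elim (v∉X (sealed u∉X uv refl differ))

  one-sided : ∀ {x xs} → Linked (Adj G) (x ∷ xs) → All (¬_ ∘ InX) (x ∷ xs) → All (λ v → part v ≡ part x) (x ∷ xs)
  one-sided [-]         _                            = refl ∷ []
  one-sided (xy ∷ walk) (x∉X ∷ outside@(y∉X ∷ _)) =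
    refl ∷ All-map (λ same → trans same (adjacent-same-side x∉X y∉X xy)) (one-sided walk outside)

  same-side : ∀ {l u w} → Linked (Adj G) l → All (¬_ ∘ InX) l → u ∈ l → w ∈ l → part u ≡ part w
  same-side {_ ∷ _} walk outside u∈l w∈l = trans (All-lookup sides u∈l) (≡-sym (All-lookup sides w∈l))
    where sides = one-sided walk outside

  meets-X : ∀ {l} → Linked (Adj G) l →
    (Σ Vertex λ u → u ∈ l × part u ≡ inM) → (Σ Vertex λ w → w ∈ l × part w ≡ inN) → Any InX l
  meets-X {l} walk (u , u∈l , pu) (w , w∈l , pw) with any? (λ v → part v ≟ inX) l
  ... | yes hit = hit
  ... | no miss with trans (≡-sym pu) (trans (same-side walk (¬Any⇒All¬ l miss) u∈l w∈l) pw)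
  ...   | ()

  record Traversal (P : Path G) (a b : Part) : Set where
    field
      vertices : List Vertex
      ↭verts   : vertices ↭ verts P
      linked   : Linked (Adj G) vertices
      starts   : StartsIn a vertices
      ends     : EndsIn b vertices

  ends-verts : ∀ {a} (P : Path G) → part (endR P) ≡ a → EndsIn a (verts P)
  ends-verts P pr = subst (AllMaybe _) (≡-sym (last-lastOf (start P) (rest P))) (just pr)

  forward : ∀ {a b} (P : Path G) → part (endL P) ≡ a → part (endR P) ≡ b → Traversal P a b
  forward P pl pr = record
    { vertices = verts P ; ↭verts = ↭-refl ; linked = walk P ; starts = just pl ; ends = ends-verts P pr }

  backward : ∀ {a b} (P : Path G) → part (endR P) ≡ a → part (endL P) ≡ b → Traversal P a b
  backward P pr pl = record
    { vertices = reverse (verts P)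
    ; ↭verts   = ↭-reverse (verts P)
    ; linked   = Linked-reverse (sym G) (walk P)
    ; starts   = subst (AllMaybe _) (≡-sym (head-reverse (verts P))) (ends-verts P pr)
    ; ends     = subst (AllMaybe _) (≡-sym (last-reverse (verts P))) (just pl)
    }

  data Shape (P : Path G) : ℕ → Set where
    N-N : Traversal P inN inN → Shape P 0
    M-N : Traversal P inM inN → Shape P 1
    M-M : Traversal P inM inM → Shape P 2

  shape : (P : Path G) → part (endL P) ≢ inX → part (endR P) ≢ inX → Shape P (f P part)
  shape P = classify (part (endL P)) (part (endR P)) refl refl
    where
      classify : ∀ a b → part (endL P) ≡ a → part (endR P) ≡ b → a ≢ inX → b ≢ inX → Shape P (indM a + indM b)
      classify inX _   _  _  a≢X _   = ⊥-elim (a≢X refl)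
      classify _   inX _  _  _   b≢X = ⊥-elim (b≢X refl)
      classify inM inM pl pr _   _   = M-M (forward P pl pr)
      classify inN inN pl pr _   _   = N-N (forward P pl pr)
      classify inM inN pl pr _   _   = M-N (forward P pl pr)
      classify inN inM pl pr _   _   = M-N (backward P pr pl)

  open Traversal

  cross : ∀ {R S} (t : Traversal R inM inN) (u : Traversal S inM inN) → Splice inN inM (vertices t) (vertices u)
  cross t u = crossing-splice N-M (linked t) (ends t) (linked u) (starts u)

  insert : ∀ {R S d e} → Opposite d e → (t : Traversal R e e) (u : Traversal S e e) →
    (Σ Vertex λ v → v ∈ verts R × part v ≡ d) → Splice d e (vertices t) (vertices u)
  insert de t u (v , v∈R , pv) =
    inserting-splice de (linked t) (∈-resp-↭ (↭-sym (↭verts t)) v∈R) pv (linked u) (starts u) (ends u)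

  module Detours (P Q : Path G) (P-detour : IsDetour G P) (Q-detour : IsDetour G Q)
    (P-M : Σ Vertex λ v → v ∈ verts P × part v ≡ inM) (P-N : Σ Vertex λ v → v ∈ verts P × part v ≡ inN)
    (Q-M : Σ Vertex λ v → v ∈ verts Q × part v ≡ inM) (Q-N : Σ Vertex λ v → v ∈ verts Q × part v ≡ inN)
    (noX : NoCommonX (verts P) (verts Q)) where

    splice-pair-impossible : ∀ {d e A B} → Opposite d e → A ↭ verts P → B ↭ verts Q →
      Splice d e A B → Splice d e B A → ⊥
    splice-pair-impossible {A = A} {B} de A↭ B↭ AB BA =
      exchanged-deletions-exceed de A B A-meets-X (↭-length A↭)
        (subst (order P ≤_) (≡-sym (↭-length B↭)) (Q-detour P))
        (splice-bound {P} P-detour de noX-AB A-unique B-unique AB)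
        (splice-bound {P} P-detour de (λ v∈B v∈A → noX-AB v∈A v∈B) B-unique A-unique BA)
      where
        A-meets-X = Any-resp-↭ (↭-sym A↭) (meets-X (walk P) P-M P-N)
        A-unique = Unique-resp-↭ (↭-sym A↭) (distinct P)
        B-unique = Unique-resp-↭ (↭-sym B↭) (distinct Q)
        noX-AB : NoCommonX A B
        noX-AB v∈A v∈B = noX (∈-resp-↭ A↭ v∈A) (∈-resp-↭ B↭ v∈B)

    equal-shapes-impossible : ∀ {k} → Shape P k → Shape Q k → ⊥
    equal-shapes-impossible (M-N p) (M-N q) =
      splice-pair-impossible N-M (↭verts p) (↭verts q) (cross p q) (cross q p)
    equal-shapes-impossible (M-M p) (M-M q) =
      splice-pair-impossible N-M (↭verts p) (↭verts q) (insert N-M p q P-N) (insert N-M q p Q-N)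
    equal-shapes-impossible (N-N p) (N-N q) =
      splice-pair-impossible M-N (↭verts p) (↭verts q) (insert M-N p q P-M) (insert M-N q p Q-M)

lemma2 : ∀ {n : ℕ} (G : Graph n) (part : Fin n → Part) →
    IsSeparation G part → IsCliqueX G part → IsCutSetX G part →
    (P Q : Path G) → IsDetour G P → IsDetour G Q →
    part (endL P) ≢ inX → part (endR P) ≢ inX →
    part (endL Q) ≢ inX → part (endR Q) ≢ inX →
    Σ (Fin n) (λ v → v ∈ verts P × part v ≡ inM) →
    Σ (Fin n) (λ v → v ∈ verts P × part v ≡ inN) →
    Σ (Fin n) (λ v → v ∈ verts Q × part v ≡ inM) →
    Σ (Fin n) (λ v → v ∈ verts Q × part v ≡ inN) →
    f P part ≡ f Q part →
    Σ (Fin n) (λ v → v ∈ verts P × v ∈ verts Q × part v ≡ inX)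
lemma2 G part sep clique _ P Q P-detour Q-detour P-left P-right Q-left Q-right P-M P-N Q-M Q-N f≡
  with Labelling.common-X? part (verts P) (verts Q)
... | yes common = common
... | no none =
  ⊥-elim (equal-shapes-impossible (shape P P-left P-right) (subst (Shape Q) (≡-sym f≡) (shape Q Q-left Q-right)))
  where
    open Separation G part sep clique
    open Detours P Q P-detour Q-detour P-M P-N Q-M Q-N (λ v∈P v∈Q vX → none (_ , v∈P , v∈Q , vX))
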